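{- Let $G$ be a finite group and $\Gamma=\mathrm{Cay}(G,S_{i,j}:1\le i,j\le m)$ an $m$-Cayley digraph of $G$. Then $\Gamma$ is K$m$CI if and only if the normalizer $N_{\mathrm{Aut}(\Gamma)}(R(G))$ induces the full symmetric group on $\{G_1,\dots,G_m\}$ and every semiregular subgroup of $\mathrm{Aut}(\Gamma)$ isomorphic to $G$ is conjugate to $R(G)$ in $\mathrm{Aut}(\Gamma)$.
   Context: For subsets $S_{i,j}\subseteq G$, $\mathrm{Cay}(G,S_{i,j}:1\le i,j\le m)$ is the digraph with vertex set $\bigcup_i G_i$, $G_i=\{x_i:x\in G\}$, and arcs $(x_i,(sx)_j)$ for $s\in S_{i,j}$, $x\in G$; these are the $m$-Cayley digraphs of $G$ (on the same vertex set). $R(g):x_i\mapsto(xg)_i$ and $R(G)=\{R(g):g\in G\}\le\mathrm{Aut}(\Gamma)$, with orbits $G_1,\dots,G_m$. A permutation group is semiregular if all point stabilizers are trivial. $N$ is the normalizer of $R(G)$ in the symmetric group on the vertex set and $K$ the kernel of $N$ acting on $\{G_1,\dots,G_m\}$. $\Gamma$ is K$m$CI if for every $m$-Cayley digraph $\Sigma$ of $G$ isomorphic to $\Gamma$ there exists $k\in K$ with $\Gamma^k=\Sigma$. -}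

module Defs where

open import Data.Nat using (ℕ)
open import Data.Fin using (Fin)
open import Data.Fin.Subset using (Subset; _∈_)
open import Data.Product using (Σ; ∃; ∃-syntax; _×_; _,_; proj₁)
open import Function.Bundles using (_↔_; _⇔_; Inverse)
open import Algebra.Structures using (IsGroup)
open import Relation.Binary.PropositionalEquality using (_≡_)

-- A finite group: carrier Fin order (every finite group is isomorphic to one of these),
-- with the library's IsGroup structure w.r.t. propositional equality.
record FinGroup : Set where
  infixl 7 _∙_
  field
    order   : ℕ
    _∙_     : Fin order → Fin order → Fin order
    ε       : Fin order
    _⁻¹     : Fin order → Fin order
    isGroup : IsGroup _≡_ _∙_ ε _⁻¹

module _ (G : FinGroup) (m : ℕ) where
  open FinGroup G

  El : Set
  El = Fin order

  -- Vertex set ⋃ G_i : the pair (i , x) is the vertex x_i (i ∈ Fin m indexes 1..m).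
  V : Set
  V = Fin m × El

  MCay : Set
  MCay = Fin m → Fin m → Subset order

  -- Arcs: (x_i , (s x)_j) for s ∈ S_{i,j}; i.e. (x_i , y_j) is an arc iff y x⁻¹ ∈ S_{i,j}.
  Arc : MCay → V → V → Set
  Arc S (i , x) (j , y) = (y ∙ (x ⁻¹)) ∈ S i j

  Perm : Set
  Perm = V ↔ V

  R : El → V → V
  R g (i , x) = (i , x ∙ g)

  IsIso : MCay → MCay → Perm → Set
  IsIso S S' σ = ∀ u v → Arc S u v ⇔ Arc S' (Inverse.to σ u) (Inverse.to σ v)

  IsAut : MCay → Perm → Set
  IsAut S σ = IsIso S S σ

  Normalizes : Perm → Set
  Normalizes σ =
    (∀ g → ∃[ h ] (∀ v → Inverse.from σ (R g (Inverse.to σ v)) ≡ R h v)) ×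
    (∀ h → ∃[ g ] (∀ v → Inverse.from σ (R g (Inverse.to σ v)) ≡ R h v))

  InK : Perm → Set
  InK σ = Normalizes σ × (∀ v → proj₁ (Inverse.to σ v) ≡ proj₁ v)

  KmCI : MCay → Set
  KmCI S = ∀ (S' : MCay) → (∃[ σ ] IsIso S S' σ) → ∃[ k ] (InK k × IsIso S S' k)

  NormInducesFullSym : MCay → Set
  NormInducesFullSym S =
    ∀ (π : Fin m ↔ Fin m) → ∃[ σ ] (IsAut S σ × Normalizes σ ×
      (∀ i x → proj₁ (Inverse.to σ (i , x)) ≡ Inverse.to π i))

  -- A semiregular subgroup of Aut(Γ) isomorphic to G, presented as the image of an
  -- injective homomorphism φ : G → Aut(Γ) whose image is semiregular.
  record SemiregularCopy (S : MCay) : Set where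
    field
      φ       : El → Perm
      aut     : ∀ g → IsAut S (φ g)
      hom     : ∀ g h v → Inverse.to (φ (g ∙ h)) v ≡ Inverse.to (φ h) (Inverse.to (φ g) v)
      inj     : ∀ g h → (∀ v → Inverse.to (φ g) v ≡ Inverse.to (φ h) v) → g ≡ h
      semireg : ∀ g v → Inverse.to (φ g) v ≡ v → ∀ w → Inverse.to (φ g) w ≡ w

  ConjugateToR : (S : MCay) → SemiregularCopy S → Set
  ConjugateToR S H = ∃[ σ ] (IsAut S σ ×
    (∀ g → ∃[ h ] (∀ v → Inverse.from σ (Inverse.to (φ g) (Inverse.to σ v)) ≡ R h v)) ×
    (∀ h → ∃[ g ] (∀ v → Inverse.from σ (Inverse.to (φ g) (Inverse.to σ v)) ≡ R h v)))
    where open SemiregularCopy H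

  AllSemiregularConjugate : MCay → Set
  AllSemiregularConjugate S = (H : SemiregularCopy S) → ConjugateToR S H

-- Relabelling the orbits G_i by a permutation π gives an m-Cayley digraph isomorphic to Γ,
-- so KmCI provides an element k of K doing the same; the relabelling followed by k⁻¹ lies
-- in N_{Aut(Γ)}(R(G)) and induces π.  A semiregular copy of G in Aut(Γ) acts freely, so by
-- counting it has exactly m orbits, and one base point per orbit gives a bijection θ
-- intertwining R(G) with the copy.  Pulling Γ back along θ yields an m-Cayley digraph
-- Σ ≅ Γ; the element of K mapping Γ to Σ, followed by θ, conjugates the copy onto R(G).
-- Conversely, an isomorphism σ from Γ to an m-Cayley digraph Σ conjugates R(G) to a
-- semiregular copy in Aut(Γ); conjugating that copy back onto R(G) inside Aut(Γ) turns σ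
-- into an isomorphism normalising R(G).  Such a map permutes the orbits, and an element of
-- the normaliser inducing the inverse permutation corrects it to an element of K.
module Submission where

open import Defs
open import Algebra.Bundles using (Group)
open import Algebra.Structures using (IsGroup)
import Algebra.Properties.Group as GroupProperties
open import Data.Empty using (⊥-elim)
open import Data.Fin using (Fin; zero; suc) renaming (_≟_ to _≟ᶠ_)
open import Data.Fin.Properties using (any?; injective⇒≤; *↔×; nonZeroIndex)
open import Data.Fin.Subset using (_∈_)
open import Data.Fin.Subset.Properties using (_∈?_)
open import Data.Nat using (ℕ; zero; suc; _≤_)
open import Data.Nat.Properties using (*-cancelʳ-≤; ≤-refl; <⇒≤; <⇒≱; 1+n≰n)
open import Data.Product using (Σ; ∃; ∃-syntax; _×_; _,_; proj₁; proj₂; map₁)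
open import Data.Product.Properties using (≡-dec)
open import Data.Vec using (tabulate)
open import Data.Vec.Functional using (_∷_)
open import Data.Vec.Properties using (lookup∘tabulate; []=⇒lookup; lookup⇒[]=)
open import Function.Base using (_∘_)
open import Function.Bundles using (_⇔_; _↔_; _↣_; Inverse; Injection; mk⇔; mk↔ₛ′; mk↣)
open import Function.Definitions using (Injective)
open import Function.Construct.Composition using () renaming (equivalence to ⇔-trans)
open import Function.Construct.Identity using (⇔-id)
open import Function.Construct.Symmetry using (⇔-sym)
open import Function.Properties.Injection using (↣-trans)
open import Function.Properties.Inverse using (↔-refl; ↔-sym; ↔-trans; ↔⇒↣)
open import Relation.Binary.PropositionalEquality
open import Relation.Nullary using (Dec; yes; no; ¬_; ¬?; does; proof)
open import Relation.Nullary.Decidable using (dec-true; decidable-stable; map′)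
open import Relation.Nullary.Reflects using (Reflects; invert)

open Inverse using (to; from; strictlyInverseˡ; strictlyInverseʳ)
open ≡-Reasoning

from-injective : ∀ {A B : Set} (f : A ↔ B) → Injective _≡_ _≡_ (from f)
from-injective f = Injection.injective (↔⇒↣ (↔-sym f))

to-injective : ∀ {A B : Set} (f : A ↔ B) → Injective _≡_ _≡_ (to f)
to-injective f = Injection.injective (↔⇒↣ f)

×-injective⇒≤ : ∀ {a b n} → Fin n → (Fin a × Fin n) ↣ (Fin b × Fin n) → a ≤ b
×-injective⇒≤ {a} {b} {n} x f = *-cancelʳ-≤ a b n {{nonZeroIndex x}}
  (injective⇒≤ (Injection.injective (↣-trans (↔⇒↣ *↔×) (↣-trans f (↔⇒↣ (↔-sym *↔×))))))

∃×? : ∀ {k n} {P : Fin k × Fin n → Set} → (∀ p → Dec (P p)) → Dec (∃ P)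
∃×? P? = map′ (λ (i , x , p) → (i , x) , p) (λ ((i , x) , p) → i , x , p)
  (any? λ i → any? λ x → P? (i , x))

inhabited? : ∀ n → Dec (Fin n)
inhabited? zero    = no λ ()
inhabited? (suc n) = yes zero

∈-tabulate⇔ : ∀ {n} {P : Fin n → Set} (P? : ∀ x → Dec (P x)) x →
              x ∈ tabulate (does ∘ P?) ⇔ P x
∈-tabulate⇔ P? x = mk⇔
  (λ x∈ → invert (subst (Reflects _) (trans (sym (lookup∘tabulate _ x)) ([]=⇒lookup x∈))
                                     (proof (P? x))))
  (λ px → lookup⇒[]= x _ (trans (lookup∘tabulate _ x) (dec-true (P? x) px)))

module _ (G : FinGroup) (m : ℕ) where
  open FinGroup G
  open IsGroup isGroup using (assoc; identityˡ; identityʳ; inverseʳ)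
  private
    group : Group _ _
    group = record { isGroup = isGroup }

  open GroupProperties group using (∙-cancelˡ; identityʳ-unique; x∙y⁻¹≈ε⇒x≈y; ⁻¹-anti-homo-∙;
           \\-leftDividesˡ; //-rightDividesˡ; //-rightDividesʳ)

  Vertex : Set
  Vertex = V G m

  R-∙ : ∀ g h w → R G m (g ∙ h) w ≡ R G m h (R G m g w)
  R-∙ g h (i , x) = cong (i ,_) (sym (assoc x g h))

  R-ε : ∀ w → R G m ε w ≡ w
  R-ε (i , x) = cong (i ,_) (identityʳ x)

  R-orbit : ∀ g w → proj₁ (R G m g w) ≡ proj₁ w
  R-orbit g (i , x) = refl

  R-cancelʳ : ∀ {g h} w → R G m g w ≡ R G m h w → g ≡ h
  R-cancelʳ (i , x) e = ∙-cancelˡ x _ _ (cong proj₂ e)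

  R-fixed⇒ε : ∀ {g} w → R G m g w ≡ w → g ≡ ε
  R-fixed⇒ε (i , x) e = identityʳ-unique x _ (cong proj₂ e)

  R↔ : El G m → Perm G m
  R↔ g = mk↔ₛ′ (R G m g) (R G m (g ⁻¹))
    (λ (i , x) → cong (i ,_) (//-rightDividesˡ g x))
    (λ (i , x) → cong (i ,_) (//-rightDividesʳ g x))

  ∙ʳ-preserves-quotient : ∀ x y g → (y ∙ g) ∙ (x ∙ g) ⁻¹ ≡ y ∙ x ⁻¹
  ∙ʳ-preserves-quotient x y g = begin
    (y ∙ g) ∙ (x ∙ g) ⁻¹     ≡⟨ cong ((y ∙ g) ∙_) (⁻¹-anti-homo-∙ x g) ⟩
    (y ∙ g) ∙ (g ⁻¹ ∙ x ⁻¹)  ≡⟨ assoc (y ∙ g) (g ⁻¹) (x ⁻¹) ⟨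
    (y ∙ g) ∙ g ⁻¹ ∙ x ⁻¹    ≡⟨ cong (_∙ x ⁻¹) (//-rightDividesʳ g y) ⟩
    y ∙ x ⁻¹                 ∎

  Arc-resp : ∀ {S u u′ v v′} → u ≡ u′ → v ≡ v′ → Arc G m S u v ⇔ Arc G m S u′ v′
  Arc-resp refl refl = ⇔-id _

  R-isAut : ∀ S g → IsAut G m S (R↔ g)
  R-isAut S g (i , x) (j , y) =
    subst (λ z → (y ∙ x ⁻¹) ∈ S i j ⇔ z ∈ S i j) (sym (∙ʳ-preserves-quotient x y g)) (⇔-id _)

  isIso-trans : ∀ {S₁ S₂ S₃} σ τ → IsIso G m S₁ S₂ σ → IsIso G m S₂ S₃ τ →
                IsIso G m S₁ S₃ (↔-trans σ τ)
  isIso-trans σ τ σ-iso τ-iso u v = ⇔-trans (σ-iso u v) (τ-iso (to σ u) (to σ v))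

  isIso-sym : ∀ {S₁ S₂} σ → IsIso G m S₁ S₂ σ → IsIso G m S₂ S₁ (↔-sym σ)
  isIso-sym {S₁} {S₂} σ σ-iso u v = ⇔-sym (⇔-trans (σ-iso (from σ u) (from σ v))
                                          (Arc-resp {S₂} (strictlyInverseˡ σ u) (strictlyInverseˡ σ v)))

  Conjugates : Perm G m → El G m → El G m → Set
  Conjugates σ g h = ∀ v → from σ (R G m g (to σ v)) ≡ R G m h v

  conjugates-trans : ∀ σ τ {g g′ h} → Conjugates τ g g′ → Conjugates σ g′ h →
                     Conjugates (↔-trans σ τ) g h
  conjugates-trans σ τ τ-conj σ-conj v = trans (cong (from σ) (τ-conj (to σ v))) (σ-conj v)

  conjugates-sym : ∀ σ {g h} → Conjugates σ g h → Conjugates (↔-sym σ) h g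
  conjugates-sym σ {g} {h} σ-conj v = begin
    to σ (R G m h (from σ v))                  ≡⟨ cong (to σ) (σ-conj (from σ v)) ⟨
    to σ (from σ (R G m g (to σ (from σ v))))  ≡⟨ strictlyInverseˡ σ _ ⟩
    R G m g (to σ (from σ v))                  ≡⟨ cong (R G m g) (strictlyInverseˡ σ v) ⟩
    R G m g v                                  ∎

  conjugates⇒commutes : ∀ σ {g h} → Conjugates σ g h → ∀ v → to σ (R G m h v) ≡ R G m g (to σ v)
  conjugates⇒commutes σ σ-conj v =
    trans (cong (to σ) (sym (σ-conj v))) (strictlyInverseˡ σ _)

  normalizes-trans : ∀ σ τ → Normalizes G m σ → Normalizes G m τ → Normalizes G m (↔-trans σ τ)
  normalizes-trans σ τ (σ-into , σ-onto) (τ-into , τ-onto) =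
    (λ g → let (g′ , τ-conj) = τ-into g ; (h , σ-conj) = σ-into g′
           in h , conjugates-trans σ τ τ-conj σ-conj) ,
    (λ h → let (g′ , σ-conj) = σ-onto h ; (g , τ-conj) = τ-onto g′
           in g , conjugates-trans σ τ τ-conj σ-conj)

  normalizes-sym : ∀ σ → Normalizes G m σ → Normalizes G m (↔-sym σ)
  normalizes-sym σ (σ-into , σ-onto) =
    (λ h → let (g , σ-conj) = σ-onto h in g , conjugates-sym σ σ-conj) ,
    (λ g → let (h , σ-conj) = σ-into g in h , conjugates-sym σ σ-conj)

  relabel : MCay G m → (Fin m ↔ Fin m) → MCay G m
  relabel S π i j = S (from π i) (from π j)

  relabel↔ : (Fin m ↔ Fin m) → Perm G m
  relabel↔ π = mk↔ₛ′ (map₁ (to π)) (map₁ (from π))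
    (λ (i , x) → cong (_, x) (strictlyInverseˡ π i))
    (λ (i , x) → cong (_, x) (strictlyInverseʳ π i))

  relabel↔-isIso : ∀ S π → IsIso G m S (relabel S π) (relabel↔ π)
  relabel↔-isIso S π (i , x) (j , y) =
    subst₂ (λ i′ j′ → (y ∙ x ⁻¹) ∈ S i j ⇔ (y ∙ x ⁻¹) ∈ S i′ j′)
           (sym (strictlyInverseʳ π i)) (sym (strictlyInverseʳ π j)) (⇔-id _)

  relabel↔-normalizes : ∀ π → Normalizes G m (relabel↔ π)
  relabel↔-normalizes π = (λ g → g , conj g) , (λ g → g , conj g)
    where
    conj : ∀ g → Conjugates (relabel↔ π) g g
    conj g (i , x) = cong (_, x ∙ g) (strictlyInverseʳ π i)

  KmCI⇒normInducesFullSym : ∀ S → KmCI G m S → NormInducesFullSym G m S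
  KmCI⇒normInducesFullSym S kmci π with kmci (relabel S π) (relabel↔ π , relabel↔-isIso S π)
  ... | k , (k-norm , k-fixes) , k-iso =
    ↔-trans (relabel↔ π) (↔-sym k) ,
    isIso-trans {S} {relabel S π} {S} (relabel↔ π) (↔-sym k) (relabel↔-isIso S π)
                (isIso-sym {S} {relabel S π} k k-iso) ,
    normalizes-trans (relabel↔ π) (↔-sym k) (relabel↔-normalizes π) (normalizes-sym k k-norm) ,
    λ i x → trans (sym (k-fixes _)) (cong proj₁ (strictlyInverseˡ k (to π i , x)))

  normalizes⇒orbitwise : ∀ ρ → Normalizes G m ρ →
                         ∀ i x y → proj₁ (to ρ (i , x)) ≡ proj₁ (to ρ (i , y))
  normalizes⇒orbitwise ρ (_ , ρ-onto) i x y with ρ-onto (x ⁻¹ ∙ y)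
  ... | g , ρ-conj = begin
    proj₁ (to ρ (i , x))                 ≡⟨ R-orbit g (to ρ (i , x)) ⟨
    proj₁ (R G m g (to ρ (i , x)))       ≡⟨ cong proj₁ (conjugates⇒commutes ρ ρ-conj (i , x)) ⟨
    proj₁ (to ρ (i , x ∙ (x ⁻¹ ∙ y)))    ≡⟨ cong (λ z → proj₁ (to ρ (i , z))) (\\-leftDividesˡ x y) ⟩
    proj₁ (to ρ (i , y))                 ∎

  orbitPerm : ∀ ρ → Normalizes G m ρ → Fin m ↔ Fin m
  orbitPerm ρ ρ-norm = mk↔ₛ′ (λ i → proj₁ (to ρ (i , ε))) (λ j → proj₁ (from ρ (j , ε)))
    (λ j → trans (normalizes⇒orbitwise ρ ρ-norm _ ε _)
                 (cong proj₁ (strictlyInverseˡ ρ (j , ε))))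
    (λ i → trans (normalizes⇒orbitwise (↔-sym ρ) (normalizes-sym ρ ρ-norm) _ ε _)
                 (cong proj₁ (strictlyInverseʳ ρ (i , ε))))

  align-orbits : ∀ {S S′} ρ → NormInducesFullSym G m S → IsIso G m S S′ ρ → Normalizes G m ρ →
                 ∃[ k ] (InK G m k × IsIso G m S S′ k)
  align-orbits {S} {S′} ρ fullSym ρ-iso ρ-norm with fullSym (orbitPerm ρ ρ-norm)
  ... | μ , μ-aut , μ-norm , μ-orbits =
    ↔-trans (↔-sym μ) ρ ,
    (normalizes-trans (↔-sym μ) ρ (normalizes-sym μ μ-norm) ρ-norm , fixes) ,
    isIso-trans {S} {S} {S′} (↔-sym μ) ρ (isIso-sym {S} {S} μ μ-aut) ρ-iso
    where
    fixes : ∀ v → proj₁ (to ρ (from μ v)) ≡ proj₁ v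
    fixes v = begin
      proj₁ (to ρ (from μ v))             ≡⟨ normalizes⇒orbitwise ρ ρ-norm _ _ ε ⟩
      to (orbitPerm ρ ρ-norm) (proj₁ (from μ v)) ≡⟨ μ-orbits _ _ ⟨
      proj₁ (to μ (from μ v))             ≡⟨ cong proj₁ (strictlyInverseˡ μ v) ⟩
      proj₁ v                             ∎

  -- The vertex v₀ is only needed for injectivity of g ↦ σ R(g) σ⁻¹, which fails for m = 0.
  conjugateCopy : ∀ {S S′} σ → IsIso G m S S′ σ → Vertex → SemiregularCopy G m S
  conjugateCopy {S} {S′} σ σ-iso v₀ = record
    { φ       = φ
    ; aut     = λ g → isIso-trans {S} {S′} {S} (↔-trans σ (R↔ g)) (↔-sym σ)
                        (isIso-trans {S} {S′} {S′} σ (R↔ g) σ-iso (R-isAut S′ g))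
                        (isIso-sym {S} {S′} σ σ-iso)
    ; hom     = λ g h v → cong (from σ) (trans (R-∙ g h _)
                            (cong (R G m h) (sym (strictlyInverseˡ σ _))))
    ; inj     = λ g h e → R-cancelʳ (to σ v₀) (from-injective σ (e v₀))
    ; semireg = semireg
    }
    where
    φ : El G m → Perm G m
    φ g = ↔-trans (↔-trans σ (R↔ g)) (↔-sym σ)

    semireg : ∀ g v → to (φ g) v ≡ v → ∀ w → to (φ g) w ≡ w
    semireg g v e w rewrite R-fixed⇒ε (to σ v) (from-injective σ (trans e (sym (strictlyInverseʳ σ v))))
      = trans (cong (from σ) (R-ε _)) (strictlyInverseʳ σ w)

  conjugateToR⇒normalizingIso : ∀ {S S′} σ (σ-iso : IsIso G m S S′ σ) v₀ →
    ConjugateToR G m S (conjugateCopy {S} {S′} σ σ-iso v₀) →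
    ∃[ ρ ] (IsIso G m S S′ ρ × Normalizes G m ρ)
  conjugateToR⇒normalizingIso {S} {S′} σ σ-iso v₀ (τ , τ-aut , τ-conj) =
    ↔-trans τ σ , isIso-trans {S} {S} {S′} τ σ τ-aut σ-iso , τ-conj

  no-vertices⇒KmCI : ¬ Fin m → ∀ S → KmCI G m S
  no-vertices⇒KmCI ∄i S S′ _ =
    ↔-refl , (((λ g → g , λ v → absurd v) , (λ g → g , λ v → absurd v)) , λ v → absurd v) ,
    λ u v → absurd u
    where
    absurd : {A : Set} → Vertex → A
    absurd (i , _) = ⊥-elim (∄i i)

  conditions⇒KmCI : ∀ S → NormInducesFullSym G m S → AllSemiregularConjugate G m S → KmCI G m S
  conditions⇒KmCI S fullSym allConj S′ (σ , σ-iso) with inhabited? m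
  ... | no ∄i = no-vertices⇒KmCI ∄i S S′ (σ , σ-iso)
  ... | yes i₀ with conjugateToR⇒normalizingIso {S} {S′} σ σ-iso (i₀ , ε)
                  (allConj (conjugateCopy {S} {S′} σ σ-iso (i₀ , ε)))
  ...   | ρ , ρ-iso , ρ-norm = align-orbits {S} {S′} ρ fullSym ρ-iso ρ-norm

  module FreeAction (act : El G m → Vertex → Vertex)
                    (act-∙ : ∀ g h v → act (g ∙ h) v ≡ act h (act g v))
                    (act-ε : ∀ v → act ε v ≡ v)
                    (free : ∀ g v → act g v ≡ v → g ≡ ε) where

    act-inverse : ∀ x v → act (x ⁻¹) (act x v) ≡ v
    act-inverse x v = begin
      act (x ⁻¹) (act x v)  ≡⟨ act-∙ x (x ⁻¹) v ⟨
      act (x ∙ x ⁻¹) v      ≡⟨ cong (λ z → act z v) (inverseʳ x) ⟩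
      act ε v               ≡⟨ act-ε v ⟩
      v                     ∎

    act-transfer : ∀ {x y u v} → act x v ≡ act y u → act (y ∙ x ⁻¹) u ≡ v
    act-transfer {x} {y} {u} {v} e = begin
      act (y ∙ x ⁻¹) u      ≡⟨ act-∙ y (x ⁻¹) u ⟩
      act (x ⁻¹) (act y u)  ≡⟨ cong (act (x ⁻¹)) e ⟨
      act (x ⁻¹) (act x v)  ≡⟨ act-inverse x v ⟩
      v                     ∎

    act-cancelʳ : ∀ {x y} v → act x v ≡ act y v → x ≡ y
    act-cancelʳ {x} {y} v e = x∙y⁻¹≈ε⇒x≈y x y (free _ v (act-transfer (sym e)))

    orbitMap : ∀ {k} → (Fin k → Vertex) → Fin k × El G m → Vertex
    orbitMap r (i , x) = act x (r i)

    Transversal : ∀ {k} → (Fin k → Vertex) → Set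
    Transversal r = Injective _≡_ _≡_ (orbitMap r)

    Covers : ∀ {k} → (Fin k → Vertex) → Vertex → Set
    Covers r v = ∃ λ p → orbitMap r p ≡ v

    covers? : ∀ {k} (r : Fin k → Vertex) v → Dec (Covers r v)
    covers? r v = ∃×? λ p → ≡-dec _≟ᶠ_ _≟ᶠ_ (orbitMap r p) v

    transversal-∷ : ∀ {k} {r : Fin k → Vertex} {v} → Transversal r → ¬ Covers r v →
                    Transversal (v ∷ r)
    transversal-∷ r-tr v∉ {zero  , x} {zero  , y} e = cong (zero ,_) (act-cancelʳ _ e)
    transversal-∷ r-tr v∉ {zero  , x} {suc j , y} e = ⊥-elim (v∉ ((j , y ∙ x ⁻¹) , act-transfer e))
    transversal-∷ r-tr v∉ {suc i , x} {zero  , y} e = ⊥-elim (v∉ ((i , x ∙ y ⁻¹) , act-transfer (sym e)))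
    transversal-∷ r-tr v∉ {suc i , x} {suc j , y} e = cong (map₁ suc) (r-tr e)

    transversal-bound : ∀ {k} {r : Fin k → Vertex} → Transversal r → k ≤ m
    transversal-bound r-tr = ×-injective⇒≤ ε (mk↣ r-tr)

    covering-bound : ∀ {k} (r : Fin k → Vertex) → (∀ v → Covers r v) → m ≤ k
    covering-bound r covers = ×-injective⇒≤ ε (mk↣ {to = proj₁ ∘ covers} λ {u} {v} e →
      trans (sym (proj₂ (covers u))) (trans (cong (orbitMap r) e) (proj₂ (covers v))))

    transversal : ∀ k → k ≤ m → Σ (Fin k → Vertex) Transversal
    transversal zero    _   = (λ ()) , λ { {() , _} }
    transversal (suc k) k<m with transversal k (<⇒≤ k<m)
    ... | r , r-tr with ∃×? (λ v → ¬? (covers? r v))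
    ...   | yes (v , v∉) = v ∷ r , transversal-∷ r-tr v∉
    ...   | no ∄v = ⊥-elim (<⇒≱ k<m (covering-bound r λ v →
                      decidable-stable (covers? r v) λ v∉ → ∄v (v , v∉)))

    transversal-covers : ∀ {r : Fin m → Vertex} → Transversal r → ∀ v → Covers r v
    transversal-covers {r} r-tr v = decidable-stable (covers? r v) λ v∉ →
      1+n≰n (transversal-bound (transversal-∷ r-tr v∉))

    equivariant↔ : Perm G m
    equivariant↔ = mk↔ₛ′ (orbitMap r) (proj₁ ∘ covers) (proj₂ ∘ covers)
                         (λ p → r-tr (proj₂ (covers (orbitMap r p))))
      where
      r = proj₁ (transversal m ≤-refl)
      r-tr = proj₂ (transversal m ≤-refl)
      covers = transversal-covers r-tr

    equivariant↔-R : ∀ g w → to equivariant↔ (R G m g w) ≡ act g (to equivariant↔ w)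
    equivariant↔-R g (i , x) = act-∙ x g _

  arc? : ∀ S u v → Dec (Arc G m S u v)
  arc? S (i , x) (j , y) = (y ∙ x ⁻¹) ∈? S i j

  module _ (S : MCay G m) (θ : Perm G m) (ψ : El G m → Perm G m)
           (ψ-aut : ∀ g → IsAut G m S (ψ g))
           (θ-R : ∀ g w → to θ (R G m g w) ≡ to (ψ g) (to θ w)) where

    pullback : MCay G m
    pullback i j = tabulate (does ∘ λ s → arc? S (to θ (i , ε)) (to θ (j , s)))

    pullback-isIso : IsIso G m pullback S θ
    pullback-isIso (i , x) (j , y) =
      ⇔-trans (∈-tabulate⇔ (λ s → arc? S (to θ (i , ε)) (to θ (j , s))) (y ∙ x ⁻¹))
        (⇔-trans (ψ-aut x _ _)
          (Arc-resp {S} (trans (sym (θ-R x (i , ε))) (cong (λ z → to θ (i , z)) (identityˡ x)))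
                    (trans (sym (θ-R x (j , _))) (cong (λ z → to θ (j , z)) (//-rightDividesˡ x y)))))

  module _ {S : MCay G m} (H : SemiregularCopy G m S) where
    open SemiregularCopy H

    copy-ε : ∀ v → to (φ ε) v ≡ v
    copy-ε v = to-injective (φ ε) (begin
      to (φ ε) (to (φ ε) v)  ≡⟨ hom ε ε v ⟨
      to (φ (ε ∙ ε)) v       ≡⟨ cong (λ g → to (φ g) v) (identityˡ ε) ⟩
      to (φ ε) v             ∎)

    copy-free : ∀ g v → to (φ g) v ≡ v → g ≡ ε
    copy-free g v e = inj g ε λ w → trans (semireg g v e w) (sym (copy-ε w))

    open FreeAction (λ g → to (φ g)) hom copy-ε copy-free

    copy-pullback : MCay G m
    copy-pullback = pullback S equivariant↔ φ aut equivariant↔-R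

    copy-pullback-isIso : IsIso G m copy-pullback S equivariant↔
    copy-pullback-isIso = pullback-isIso S equivariant↔ φ aut equivariant↔-R

    copy-pullback-≅ : ∃[ σ ] IsIso G m S copy-pullback σ
    copy-pullback-≅ =
      ↔-sym equivariant↔ , isIso-sym {copy-pullback} {S} equivariant↔ copy-pullback-isIso

    equivariant↔-conjugates : ∀ g w → from equivariant↔ (to (φ g) (to equivariant↔ w)) ≡ R G m g w
    equivariant↔-conjugates g w =
      trans (cong (from equivariant↔) (sym (equivariant↔-R g w))) (strictlyInverseʳ equivariant↔ _)

    normalizingIso⇒conjugateToR : ∀ k → Normalizes G m k → IsIso G m S copy-pullback k →
                                  ConjugateToR G m S H
    normalizingIso⇒conjugateToR k (k-into , k-onto) k-iso =
      ↔-trans k equivariant↔ ,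
      isIso-trans {S} {copy-pullback} {S} k equivariant↔ k-iso copy-pullback-isIso ,
      (λ g → let (h , k-conj) = k-into g in h , conj k-conj) ,
      (λ h → let (g , k-conj) = k-onto h in g , conj k-conj)
      where
      conj : ∀ {g h} → Conjugates k g h →
             ∀ v → from k (from equivariant↔ (to (φ g) (to equivariant↔ (to k v)))) ≡ R G m h v
      conj {g} k-conj v = trans (cong (from k) (equivariant↔-conjugates g (to k v))) (k-conj v)

  KmCI⇒allSemiregularConjugate : ∀ S → KmCI G m S → AllSemiregularConjugate G m S
  KmCI⇒allSemiregularConjugate S kmci H
    with kmci (copy-pullback H) (copy-pullback-≅ H)
  ... | k , (k-norm , _) , k-iso = normalizingIso⇒conjugateToR H k k-norm k-iso

theorem2p3 : (G : FinGroup) (m : ℕ) (S : MCay G m) →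
    KmCI G m S ⇔ (NormInducesFullSym G m S × AllSemiregularConjugate G m S)
theorem2p3 G m S = mk⇔
  (λ kmci → KmCI⇒normInducesFullSym G m S kmci , KmCI⇒allSemiregularConjugate G m S kmci)
  (λ (fullSym , allConj) → conditions⇒KmCI G m S fullSym allConj)
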